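{- For every integer $k\geq 3$, the path $P_{2^k}$ does not divide the hypercube $Q_{2k+1}$.
   Context: $Q_n$ is the $n$-dimensional hypercube: vertex set the subsets of $\{1,\ldots,n\}$, with $x,y$ adjacent iff $|x\,\Delta\, y|=1$. $P_m$ denotes the path with $m$ edges. If $H$ is isomorphic to a subgraph of $G$, $H$ divides $G$ if there exist embeddings $\theta_1,\ldots,\theta_r$ of $H$ into $G$ such that $\{E(\theta_1(H)),\ldots,E(\theta_r(H))\}$ is a partition of $E(G)$. -}

module Defs where

open import Data.Nat using (ℕ; suc; _^_; _+_; _*_)
open import Data.Fin using (Fin; toℕ)
open import Data.Fin.Subset using (Subset; _─_; _∪_; ∣_∣)
open import Data.Product using (Σ; ∃; _×_)
open import Data.Sum using (_⊎_)
open import Function.Definitions using (Injective)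
open import Relation.Binary.PropositionalEquality using (_≡_)

record Graph : Set₁ where
  field
    V   : Set
    Adj : V → V → Set

open Graph public

_Δ_ : ∀ {n} → Subset n → Subset n → Subset n
x Δ y = (x ─ y) ∪ (y ─ x)

Q : ℕ → Graph
Q n = record { V = Subset n ; Adj = λ x y → ∣ x Δ y ∣ ≡ 1 }

-- The path P_m with m edges: vertices 0,…,m, i ~ j iff |i - j| = 1.
P : ℕ → Graph
P m = record
  { V   = Fin (suc m)
  ; Adj = λ i j → (toℕ j ≡ suc (toℕ i)) ⊎ (toℕ i ≡ suc (toℕ j)) }

record Embedding (H G : Graph) : Set where
  field
    map      : V H → V G
    injective : Injective _≡_ _≡_ map
    preserves : ∀ {u v} → Adj H u v → Adj G (map u) (map v)

open Embedding public

InImage : ∀ {H G} → Embedding H G → V G → V G → Set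
InImage {H} θ a b =
  Σ (V H) λ u → Σ (V H) λ v →
    Adj H u v × (((map θ u ≡ a) × (map θ v ≡ b)) ⊎ ((map θ u ≡ b) × (map θ v ≡ a)))

Divides : Graph → Graph → Set
Divides H G =
  Σ ℕ λ r → Σ (Fin r → Embedding H G) λ θ →
    ∀ a b → Adj G a b →
      (Σ (Fin r) λ t → InImage (θ t) a b)
      × (∀ s t → InImage (θ s) a b → InImage (θ t) a b → s ≡ t)

module Submission where

-- The path P_m cannot divide the cube Q_n when n is odd and m > n; since
-- 2^k > 2k + 1 for k ≥ 3, this gives the theorem for m = 2^k, n = 2k + 1.
-- Suppose embeddings θ_1, …, θ_r of P_m partition the edges of Q_n.
--  * Vertex count.  At a vertex v that is an end of no θ_t, every path
--    through v uses exactly two of the n edges at v, so the directions at v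
--    are paired by a fixed-point-free involution and n is even.  Hence for
--    odd n every vertex is an end, and 2^n ≤ 2r.
--  * Edge count.  Oriented edges of the paths are determined by their tail
--    and direction in Q_n, as each edge of Q_n lies on one path: 2rm ≤ n 2^n.
-- Together 2^n m ≤ 2rm ≤ 2^n n, i.e. m ≤ n.

open import Defs
open import Data.Bool using (Bool; true; false; not)
open import Data.Bool.Properties using (not-¬) renaming (_≟_ to _≟ᴮ_)
open import Data.Fin using (Fin; zero; suc; toℕ; fromℕ; inject₁; lower₁; _<?_)
open import Data.Fin.Properties
  using (toℕ-injective; toℕ-fromℕ; toℕ-inject₁; toℕ-lower₁; inject₁-injective;
         <-cmp; <-asym; *↔×; 2↔Bool; injective⇒≤; any?)
open import Data.Fin.Permutation using (Permutation; permutation)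
open import Data.Fin.Subset using (Subset; ∣_∣)
open import Data.Nat using (ℕ; zero; suc; pred; _≤_; _<_; _^_; _+_; _*_; s≤s; z≤n)
open import Data.Nat.Divisibility using (_∣_; divides; ∣m+n∣m⇒∣n; m∣m*n; ∣1⇒≡1)
open import Data.Nat.Properties
  using (m≢1+n+m; +-identityʳ; +-assoc; *-assoc; *-comm; *-suc; <⇒≱; ≤-refl;
         +-mono-≤-<; *-monoˡ-≤; *-cancelˡ-≤; ^-monoʳ-≤; m^n≢0;
         +-0-commutativeMonoid; module ≤-Reasoning)
open import Algebra.Properties.CommutativeMonoid.Sum +-0-commutativeMonoid
  using (sum; sum-cong-≗; sum-permute; ∑-distrib-+)
open import Data.Product using (Σ; ∃-syntax; _×_; _,_; proj₁; proj₂; uncurry)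
open import Data.Product.Function.NonDependent.Propositional using (_×-↔_)
open import Data.Sum using (_⊎_; inj₁; inj₂)
open import Data.Vec using ([]; _∷_; updateAt)
open import Data.Vec.Properties using (∷-injectiveˡ; ∷-injectiveʳ; ≡-dec)
open import Function using (_∘_; _↔_; _↣_; mk↔ₛ′; mk↣; Injection)
open import Function.Definitions using (Injective)
open import Function.Properties.Inverse using (↔-refl; ↔-sym; ↔-trans; ↔⇒↣)
open import Function.Construct.Composition using (_↣-∘_)
open import Relation.Binary using (tri<; tri≈; tri>)
open import Relation.Binary.PropositionalEquality
open import Relation.Nullary using (¬_; Dec; yes; no; contradiction)
open import Relation.Nullary.Decidable using (map′; decidable-stable; _⊎-dec_)

size-≤ : ∀ {a b} {A B : Set} → Fin a ↔ A → Fin b ↔ B → A ↣ B → a ≤ b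
size-≤ A↔ B↔ f =
  injective⇒≤ (Injection.injective (↔⇒↣ (↔-sym B↔) ↣-∘ (f ↣-∘ ↔⇒↣ A↔)))

size-× : ∀ {a b} {A B : Set} → Fin a ↔ A → Fin b ↔ B → Fin (a * b) ↔ (A × B)
size-× A↔ B↔ = ↔-trans *↔× (A↔ ×-↔ B↔)

size-Subset : ∀ n → Fin (2 ^ n) ↔ Subset n
size-Subset zero    = mk↔ₛ′ (λ _ → []) (λ _ → zero) (λ { [] → refl }) (λ { zero → refl })
size-Subset (suc n) = ↔-trans (size-× 2↔Bool (size-Subset n)) cons↔
  where
  cons↔ : (Bool × Subset n) ↔ Subset (suc n)
  cons↔ = mk↔ₛ′ (uncurry _∷_) (λ { (b ∷ v) → b , v }) (λ { (b ∷ v) → refl }) (λ _ → refl)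

before : ∀ {n} → Fin n → Fin n → ℕ
before i j with i <? j
... | yes _ = 1
... | no _  = 0

before-pair : ∀ {n} {i j : Fin n} → i ≢ j → before i j + before j i ≡ 1
before-pair {i = i} {j} i≢j with i <? j | j <? i
... | yes i<j | yes j<i = contradiction j<i (<-asym i<j)
... | yes _   | no _    = refl
... | no _    | yes _   = refl
... | no i≮j  | no j≮i with <-cmp i j
...   | tri< i<j _ _ = contradiction i<j i≮j
...   | tri≈ _ i≡j _ = contradiction i≡j i≢j
...   | tri> _ _ j<i = contradiction j<i j≮i

sum-ones : ∀ n → sum {n} (λ _ → 1) ≡ n
sum-ones zero    = refl
sum-ones (suc n) = cong suc (sum-ones n)

-- A fixed-point-free involution f of Fin n pairs off its elements, so n is
-- even: with g i = before i (f i), n = Σᵢ (g i + g (f i)) = 2 Σᵢ g i, the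
-- second sum being the first reindexed along the permutation f.
involution-even : ∀ {n} (f : Fin n → Fin n) →
                  (∀ i → f (f i) ≡ i) → (∀ i → f i ≢ i) → 2 ∣ n
involution-even {n} f involutive fixed-point-free = divides S (begin
  n                          ≡⟨ sym (sum-ones n) ⟩
  sum {n} (λ _ → 1)          ≡⟨ sum-cong-≗ one-split ⟩
  sum (λ i → g i + g (f i))  ≡⟨ ∑-distrib-+ g (g ∘ f) ⟩
  S + sum (g ∘ f)            ≡⟨ cong (S +_) (sym (sum-permute g π)) ⟩
  S + S                      ≡⟨ cong (S +_) (sym (+-identityʳ S)) ⟩
  2 * S                      ≡⟨ *-comm 2 S ⟩
  S * 2                      ∎)
  where
  open ≡-Reasoning
  g : Fin n → ℕ
  g i = before i (f i)
  S : ℕ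
  S = sum g
  π : Permutation n n
  π = permutation f f involutive involutive
  one-split : ∀ i → 1 ≡ g i + g (f i)
  one-split i = trans (sym (before-pair (fixed-point-free i ∘ sym)))
                      (cong (λ x → g i + before (f i) x) (sym (involutive i)))

odd-not-even : ∀ k → ¬ 2 ∣ 2 * k + 1
odd-not-even k 2∣2k+1 with ∣1⇒≡1 (∣m+n∣m⇒∣n 2∣2k+1 (m∣m*n k))
... | ()

toggle : ∀ {n} → Subset n → Fin n → Subset n
toggle v i = updateAt v i not

Δ-self : ∀ {n} (v : Subset n) → ∣ v Δ v ∣ ≡ 0
Δ-self []          = refl
Δ-self (false ∷ v) = Δ-self v
Δ-self (true ∷ v)  = Δ-self v

Δ-empty : ∀ {n} (v w : Subset n) → ∣ v Δ w ∣ ≡ 0 → v ≡ w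
Δ-empty []          []          _ = refl
Δ-empty (false ∷ v) (false ∷ w) e = cong (false ∷_) (Δ-empty v w e)
Δ-empty (true ∷ v)  (true ∷ w)  e = cong (true ∷_) (Δ-empty v w e)
Δ-empty (false ∷ v) (true ∷ w)  ()
Δ-empty (true ∷ v)  (false ∷ w) ()

toggle-adjacent : ∀ {n} (v : Subset n) i → Adj (Q n) v (toggle v i)
toggle-adjacent (false ∷ v) zero    = cong suc (Δ-self v)
toggle-adjacent (true ∷ v)  zero    = cong suc (Δ-self v)
toggle-adjacent (false ∷ v) (suc i) = toggle-adjacent v i
toggle-adjacent (true ∷ v)  (suc i) = toggle-adjacent v i

direction : ∀ {n} (v w : Subset n) → Adj (Q n) v w → Fin n
direction []          []          ()
direction (false ∷ v) (false ∷ w) a = suc (direction v w a)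
direction (true ∷ v)  (true ∷ w)  a = suc (direction v w a)
direction (false ∷ v) (true ∷ w)  _ = zero
direction (true ∷ v)  (false ∷ w) _ = zero

toggle-direction : ∀ {n} (v w : Subset n) (a : Adj (Q n) v w) →
                   toggle v (direction v w a) ≡ w
toggle-direction []          []          ()
toggle-direction (false ∷ v) (false ∷ w) a = cong (false ∷_) (toggle-direction v w a)
toggle-direction (true ∷ v)  (true ∷ w)  a = cong (true ∷_) (toggle-direction v w a)
toggle-direction (false ∷ v) (true ∷ w)  a = cong (true ∷_) (Δ-empty v w (cong pred a))
toggle-direction (true ∷ v)  (false ∷ w) a = cong (false ∷_) (Δ-empty v w (cong pred a))

toggle-injective : ∀ {n} (v : Subset n) {i j} → toggle v i ≡ toggle v j → i ≡ j
toggle-injective (b ∷ v) {zero}  {zero}  _ = refl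
toggle-injective (b ∷ v) {zero}  {suc j} e = contradiction (sym (∷-injectiveˡ e)) (not-¬ refl)
toggle-injective (b ∷ v) {suc i} {zero}  e = contradiction (∷-injectiveˡ e) (not-¬ refl)
toggle-injective (b ∷ v) {suc i} {suc j} e = cong suc (toggle-injective v (∷-injectiveʳ e))

direction-unique : ∀ {n} (v w : Subset n) {i} (a : Adj (Q n) v w) →
                   toggle v i ≡ w → direction v w a ≡ i
direction-unique v w a e = toggle-injective v (trans (toggle-direction v w a) (sym e))

~-sym : ∀ {m} {x y : Fin (suc m)} → Adj (P m) x y → Adj (P m) y x
~-sym (inj₁ e) = inj₂ e
~-sym (inj₂ e) = inj₁ e

at-most-two : ∀ {m} {p a b c : Fin (suc m)} →
              Adj (P m) p a → Adj (P m) p b → Adj (P m) p c →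
              a ≡ b ⊎ a ≡ c ⊎ b ≡ c
at-most-two (inj₁ a) (inj₁ b) _        = inj₁ (toℕ-injective (trans a (sym b)))
at-most-two (inj₂ a) (inj₂ b) _        = inj₁ (toℕ-injective (cong pred (trans (sym a) b)))
at-most-two (inj₁ a) (inj₂ b) (inj₁ c) = inj₂ (inj₁ (toℕ-injective (trans a (sym c))))
at-most-two (inj₁ a) (inj₂ b) (inj₂ c) =
  inj₂ (inj₂ (toℕ-injective (cong pred (trans (sym b) c))))
at-most-two (inj₂ a) (inj₁ b) (inj₁ c) = inj₂ (inj₂ (toℕ-injective (trans b (sym c))))
at-most-two (inj₂ a) (inj₁ b) (inj₂ c) =
  inj₂ (inj₁ (toℕ-injective (cong pred (trans (sym a) c))))

other-neighbour : ∀ {m} {p q : Fin (suc m)} → p ≢ zero → p ≢ fromℕ m →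
                  Adj (P m) p q → ∃[ o ] (Adj (P m) p o × o ≢ q)
other-neighbour {p = zero} p≢0 _ _ = contradiction refl p≢0
other-neighbour {p = suc p} _ _ (inj₁ q≡p+1) =
  inject₁ p , inj₂ (cong suc (sym (toℕ-inject₁ p))) ,
  λ o≡q → m≢1+n+m (toℕ p) (trans (sym (toℕ-inject₁ p)) (trans (cong toℕ o≡q) q≡p+1))
other-neighbour {m} {p} {q} _ p≢m (inj₂ p≡q+1) =
  suc (lower₁ p m≢p) , inj₁ (cong suc (toℕ-lower₁ p m≢p)) ,
  λ o≡q → m≢1+n+m (toℕ q)
            (trans (sym (cong toℕ o≡q)) (cong suc (trans (toℕ-lower₁ p m≢p) p≡q+1)))
  where
  m≢p : m ≢ toℕ p
  m≢p m≡p = p≢m (toℕ-injective (trans (sym m≡p) (sym (toℕ-fromℕ m))))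

arc : ∀ {m} → Fin m × Bool → Fin (suc m) × Fin (suc m)
arc (j , false) = inject₁ j , suc j
arc (j , true)  = suc j , inject₁ j

arc-adjacent : ∀ {m} (e : Fin m × Bool) → Adj (P m) (proj₁ (arc e)) (proj₂ (arc e))
arc-adjacent (j , false) = inj₁ (cong suc (sym (toℕ-inject₁ j)))
arc-adjacent (j , true)  = inj₂ (cong suc (sym (toℕ-inject₁ j)))

forward≢backward : ∀ {m} {j j′ : Fin m} → arc (j , false) ≢ arc (j′ , true)
forward≢backward {j = j} {j′} e = m≢1+n+m (toℕ j′) (trans j′≡1+j (cong suc j≡1+j′))
  where
  j≡1+j′ : toℕ j ≡ suc (toℕ j′)
  j≡1+j′ = trans (sym (toℕ-inject₁ j)) (cong (toℕ ∘ proj₁) e)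
  j′≡1+j : toℕ j′ ≡ suc (toℕ j)
  j′≡1+j = sym (trans (cong (toℕ ∘ proj₂) e) (toℕ-inject₁ j′))

arc-injective : ∀ {m} → Injective _≡_ _≡_ (arc {m})
arc-injective {x = j , false} {j′ , false} e = cong (_, false) (inject₁-injective (cong proj₁ e))
arc-injective {x = j , true}  {j′ , true}  e = cong (_, true) (inject₁-injective (cong proj₂ e))
arc-injective {x = j , false} {j′ , true}  e = contradiction e forward≢backward
arc-injective {x = j , true}  {j′ , false} e = contradiction (sym e) forward≢backward

-- A passage of E through v in direction i: E visits v at a position p and
-- leaves along the edge to q, sent to toggle v i, and along another edge to o.
record Passage {m n} (E : Embedding (P m) (Q n)) (v : Subset n) (i : Fin n) : Set where
  field
    p q o : Fin (suc m)
    p~q   : Adj (P m) p q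
    p~o   : Adj (P m) p o
    o≢q   : o ≢ q
    E[p]  : map E p ≡ v
    E[q]  : map E q ≡ toggle v i

open Passage

module _ {m n} {E : Embedding (P m) (Q n)} {v : Subset n} where

  partner : ∀ {i} → Passage E v i → Fin n
  partner σ = direction v (map E (o σ)) v~E[o]
    where
    v~E[o] : Adj (Q n) v (map E (o σ))
    v~E[o] = subst (λ x → Adj (Q n) x (map E (o σ))) (E[p] σ) (preserves E (p~o σ))

  toggle-partner : ∀ {i} (σ : Passage E v i) → toggle v (partner σ) ≡ map E (o σ)
  toggle-partner σ = toggle-direction v (map E (o σ)) _

  passage-edge : ∀ {i} → Passage E v i → InImage E v (toggle v i)
  passage-edge σ = p σ , q σ , p~q σ , inj₁ (E[p] σ , E[q] σ)

  partner-edge : ∀ {i} (σ : Passage E v i) → InImage E v (toggle v (partner σ))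
  partner-edge σ = p σ , o σ , p~o σ , inj₁ (E[p] σ , sym (toggle-partner σ))

  -- The two edges of a passage have different directions, E being injective.
  partner-≢ : ∀ {i} (σ : Passage E v i) → partner σ ≢ i
  partner-≢ {i} σ partner≡i = o≢q σ (injective E (begin
    map E (o σ)             ≡⟨ sym (toggle-partner σ) ⟩
    toggle v (partner σ)    ≡⟨ cong (toggle v) partner≡i ⟩
    toggle v i              ≡⟨ sym (E[q] σ) ⟩
    map E (q σ)             ∎))
    where open ≡-Reasoning

  -- Entering along the partner edge, E leaves along the original edge:
  -- both passages sit at the same position, which has only two neighbours.
  partner-involutive : ∀ {i} (σ : Passage E v i) (τ : Passage E v (partner σ)) →
                       partner τ ≡ i
  partner-involutive σ τ with at-most-two (p~q σ) (p~o σ) p~oτ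
    where
    pτ≡pσ : p τ ≡ p σ
    pτ≡pσ = injective E (trans (E[p] τ) (sym (E[p] σ)))
    p~oτ : Adj (P m) (p σ) (o τ)
    p~oτ = subst (λ x → Adj (P m) x (o τ)) pτ≡pσ (p~o τ)
  ... | inj₁ qσ≡oσ        = contradiction (sym qσ≡oσ) (o≢q σ)
  ... | inj₂ (inj₂ oσ≡oτ) = contradiction (trans (sym oσ≡oτ) (sym qτ≡oσ)) (o≢q τ)
    where
    qτ≡oσ : q τ ≡ o σ
    qτ≡oσ = injective E (trans (E[q] τ) (toggle-partner σ))
  ... | inj₂ (inj₁ qσ≡oτ) =
    direction-unique v (map E (o τ)) _ (trans (sym (E[q] σ)) (cong (map E) qσ≡oτ))

module Decomposition {m n} (D : Divides (P m) (Q n)) where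

  r : ℕ
  r = proj₁ D

  θ : Fin r → Embedding (P m) (Q n)
  θ = proj₁ (proj₂ D)

  covered : ∀ {a b} → Adj (Q n) a b → Σ (Fin r) λ t → InImage (θ t) a b
  covered {a} {b} ab = proj₁ (proj₂ (proj₂ D) a b ab)

  same-path : ∀ {a b} → Adj (Q n) a b →
              ∀ {s t} → InImage (θ s) a b → InImage (θ t) a b → s ≡ t
  same-path {a} {b} ab {s} {t} = proj₂ (proj₂ (proj₂ D) a b ab) s t

  end : Fin r × Bool → Subset n
  end (t , false) = map (θ t) zero
  end (t , true)  = map (θ t) (fromℕ m)

  IsEnd : Subset n → Set
  IsEnd v = Σ (Fin r × Bool) λ e → end e ≡ v

  is-end? : (v : Subset n) → Dec (IsEnd v)
  is-end? v = map′ from-any to-any (any? λ t → (end (t , false) ≟ v) ⊎-dec (end (t , true) ≟ v))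
    where
    _≟_ : (x y : Subset n) → Dec (x ≡ y)
    _≟_ = ≡-dec _≟ᴮ_
    from-any : (Σ (Fin r) λ t → end (t , false) ≡ v ⊎ end (t , true) ≡ v) → IsEnd v
    from-any (t , inj₁ e) = (t , false) , e
    from-any (t , inj₂ e) = (t , true) , e
    to-any : IsEnd v → Σ (Fin r) λ t → end (t , false) ≡ v ⊎ end (t , true) ≡ v
    to-any ((t , false) , e) = t , inj₁ e
    to-any ((t , true) , e)  = t , inj₂ e

  through : ∀ {v i} t {x y} → ¬ IsEnd v → Adj (P m) x y →
            map (θ t) x ≡ v → map (θ t) y ≡ toggle v i → Passage (θ t) v i
  through t {x} {y} ¬end x~y θx≡v θy≡v′ = record
    { p = x ; q = y ; o = proj₁ second ; p~q = x~y ; p~o = proj₁ (proj₂ second)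
    ; o≢q = proj₂ (proj₂ second) ; E[p] = θx≡v ; E[q] = θy≡v′ }
    where
    second : ∃[ o ] (Adj (P m) x o × o ≢ y)
    second = other-neighbour (λ { refl → ¬end ((t , false) , θx≡v) })
                             (λ { refl → ¬end ((t , true) , θx≡v) }) x~y

  passage : ∀ {v} → ¬ IsEnd v → (i : Fin n) → Σ (Fin r) λ t → Passage (θ t) v i
  passage {v} ¬end i with covered (toggle-adjacent v i)
  ... | t , x , y , x~y , inj₁ (θx≡v , θy≡v′) = t , through t ¬end x~y θx≡v θy≡v′
  ... | t , x , y , x~y , inj₂ (θx≡v′ , θy≡v) = t , through t ¬end (~-sym x~y) θy≡v θx≡v′

  -- The partner edge lies on a single path, so a passage entering along it
  -- belongs to the same path and pairs back to the original direction.
  passage-involutive : ∀ {v i} (σ : Σ (Fin r) λ t → Passage (θ t) v i)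
                       (τ : Σ (Fin r) λ t → Passage (θ t) v (partner (proj₂ σ))) →
                       partner (proj₂ τ) ≡ i
  passage-involutive {v} (s , σ) (t , τ)
    with same-path (toggle-adjacent v _) (partner-edge σ) (passage-edge τ)
  ... | refl = partner-involutive σ τ

  non-end⇒even : ∀ {v} → ¬ IsEnd v → 2 ∣ n
  non-end⇒even ¬end = involution-even f
    (λ i → passage-involutive (passage ¬end i) (passage ¬end (f i)))
    (λ i → partner-≢ (proj₂ (passage ¬end i)))
    where
    f : Fin n → Fin n
    f i = partner (proj₂ (passage ¬end i))

  every-vertex-end : ¬ 2 ∣ n → (v : Subset n) → IsEnd v
  every-vertex-end odd v = decidable-stable (is-end? v) (odd ∘ non-end⇒even)

  -- Vertex count: choosing for each vertex an end landing on it is injective.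
  vertex-bound : ¬ 2 ∣ n → 2 ^ n ≤ r * 2
  vertex-bound odd = size-≤ (size-Subset n) (size-× ↔-refl 2↔Bool) (mk↣ {to = which} which-injective)
    where
    which : Subset n → Fin r × Bool
    which v = proj₁ (every-vertex-end odd v)
    which-injective : Injective _≡_ _≡_ which
    which-injective {v} {w} e = begin
      v                  ≡⟨ sym (proj₂ (every-vertex-end odd v)) ⟩
      end (which v)      ≡⟨ cong end e ⟩
      end (which w)      ≡⟨ proj₂ (every-vertex-end odd w) ⟩
      w                  ∎
      where open ≡-Reasoning

  -- An arc of θ t, seen in Q n through its tail and direction.
  arc-in-Q : Fin r × (Fin m × Bool) → Subset n × Fin n
  arc-in-Q (t , e) =
    map (θ t) (proj₁ (arc e)) ,
    direction (map (θ t) (proj₁ (arc e))) (map (θ t) (proj₂ (arc e)))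
              (preserves (θ t) (arc-adjacent e))

  head : Subset n × Fin n → Subset n
  head (v , i) = toggle v i

  head-arc : ∀ t e → head (arc-in-Q (t , e)) ≡ map (θ t) (proj₂ (arc e))
  head-arc t e = toggle-direction _ _ (preserves (θ t) (arc-adjacent e))

  arc-in-image : ∀ t e → InImage (θ t) (proj₁ (arc-in-Q (t , e))) (head (arc-in-Q (t , e)))
  arc-in-image t e =
    proj₁ (arc e) , proj₂ (arc e) , arc-adjacent e , inj₁ (refl , sym (head-arc t e))

  -- Arcs with the same tail and direction are the same edge of Q n, hence on
  -- the same path, hence equal since θ t is injective.
  arc-in-Q-injective : Injective _≡_ _≡_ arc-in-Q
  arc-in-Q-injective {s , e} {t , e′} eq
    with same-path (toggle-adjacent (proj₁ (arc-in-Q (s , e))) (proj₂ (arc-in-Q (s , e))))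
                   (arc-in-image s e)
                   (subst (λ w → InImage (θ t) (proj₁ w) (head w)) (sym eq) (arc-in-image t e′))
  ... | refl = cong (s ,_) (arc-injective (cong₂ _,_ tails heads))
    where
    tails : proj₁ (arc e) ≡ proj₁ (arc e′)
    tails = injective (θ s) (cong proj₁ eq)
    heads : proj₂ (arc e) ≡ proj₂ (arc e′)
    heads = injective (θ s) (trans (sym (head-arc s e)) (trans (cong head eq) (head-arc s e′)))

  -- Edge count: the r m edges, in both orientations, inject into
  -- (tail, direction) pairs of Q n.
  edge-bound : r * (m * 2) ≤ 2 ^ n * n
  edge-bound = size-≤ (size-× ↔-refl (size-× ↔-refl 2↔Bool))
                      (size-× (size-Subset n) ↔-refl)
                      (mk↣ arc-in-Q-injective)

path-divides-odd-cube⇒≤ : ∀ {m n} → ¬ 2 ∣ n → Divides (P m) (Q n) → m ≤ n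
path-divides-odd-cube⇒≤ {m} {n} odd D = *-cancelˡ-≤ (2 ^ n) {{m^n≢0 2 n}} (begin
  2 ^ n * m    ≤⟨ *-monoˡ-≤ m (vertex-bound odd) ⟩
  r * 2 * m    ≡⟨ *-assoc r 2 m ⟩
  r * (2 * m)  ≡⟨ cong (r *_) (*-comm 2 m) ⟩
  r * (m * 2)  ≤⟨ edge-bound ⟩
  2 ^ n * n    ∎)
  where
  open Decomposition D
  open ≤-Reasoning

2k+1<2^k : ∀ k → 3 ≤ k → 2 * k + 1 < 2 ^ k
2k+1<2^k 0 ()
2k+1<2^k 1 (s≤s ())
2k+1<2^k 2 (s≤s (s≤s ()))
2k+1<2^k 3 _ = ≤-refl
2k+1<2^k (suc k@(suc (suc (suc _)))) _ = begin-strict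
  2 * suc k + 1    ≡⟨ cong (_+ 1) (*-suc 2 k) ⟩
  2 + 2 * k + 1    ≡⟨ +-assoc 2 (2 * k) 1 ⟩
  2 + (2 * k + 1)  <⟨ +-mono-≤-< 2≤2^k (2k+1<2^k k (s≤s (s≤s (s≤s z≤n)))) ⟩
  2 ^ k + 2 ^ k    ≡⟨ cong (2 ^ k +_) (sym (+-identityʳ (2 ^ k))) ⟩
  2 ^ suc k        ∎
  where
  open ≤-Reasoning
  2≤2^k : 2 ≤ 2 ^ k
  2≤2^k = ^-monoʳ-≤ 2 {1} {k} (s≤s z≤n)

proposition1 : (k : ℕ) → 3 ≤ k → ¬ Divides (P (2 ^ k)) (Q (2 * k + 1))
proposition1 k 3≤k D =
  <⇒≱ (2k+1<2^k k 3≤k) (path-divides-odd-cube⇒≤ (odd-not-even k) D)
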